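{- For every integer $i\ge 1$, every normal natural deduction proof of $\varphi_i$ in purely implicational minimal propositional logic $\mathbf{M}_{\rightarrow}$ has at least $2^i$ assumption occurrences of the formula $\xi_i$.
   Context: Purely implicational minimal propositional logic $\mathbf{M}_{\rightarrow}$: formulas are built from propositional letters using only $\rightarrow$ (there is no $\bot$). Its natural deduction system (Prawitz style) has exactly two rules: $\rightarrow$-Introduction (from a derivation of $\beta$ from assumptions possibly including occurrences of $\alpha$, infer $\alpha\rightarrow\beta$, discharging any number of those occurrences of $\alpha$) and $\rightarrow$-Elimination (from $\alpha$ (minor premise) and $\alpha\rightarrow\beta$ (major premise) infer $\beta$). A proof is a derivation with no open (undischarged) assumptions; an assumption occurrence of a formula is a leaf of the derivation tree labelled by that formula. A derivation is normal if no formula occurrence is both the conclusion of an $\rightarrow$-Introduction and the major premise of an $\rightarrow$-Elimination. Let $C$ and $D_1,D_2,\dots$ be distinct propositional letters. For formulas $X,Y$ put $\chi[X,Y]=(((X\rightarrow Y)\rightarrow X)\rightarrow X)\rightarrow Y$. Define $\xi_1=\chi[D_1,C]$, $\xi_{i+1}=\chi[D_{i+1},\xi_i]$ for $i\ge 1$, and $\varphi_i=\xi_i\rightarrow C$ for $i\ge1$. -}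

module Defs where

open import Data.Nat using (ℕ; zero; suc)
import Data.Nat.Properties as ℕP
open import Data.List using (List; []; _∷_)
open import Data.List.Membership.Propositional using (_∈_)
open import Relation.Nullary using (Dec; yes; no; ¬_)
open import Relation.Binary.PropositionalEquality using (_≡_; refl; cong; cong₂)
open import Data.Empty using (⊥)
open import Data.Unit using (⊤)

infixr 6 _⇒_

data Formula : Set where
  atom : ℕ → Formula
  _⇒_  : Formula → Formula → Formula

atom-inj : ∀ {m n} → atom m ≡ atom n → m ≡ n
atom-inj refl = refl

⇒-injˡ : ∀ {a b c d} → (a ⇒ b) ≡ (c ⇒ d) → a ≡ c
⇒-injˡ refl = refl

⇒-injʳ : ∀ {a b c d} → (a ⇒ b) ≡ (c ⇒ d) → b ≡ d
⇒-injʳ refl = refl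

_≟F_ : (a b : Formula) → Dec (a ≡ b)
atom m ≟F atom n with m ℕP.≟ n
... | yes p = yes (cong atom p)
... | no ¬p = no (λ q → ¬p (atom-inj q))
atom m ≟F (c ⇒ d) = no (λ ())
(a ⇒ b) ≟F atom n = no (λ ())
(a ⇒ b) ≟F (c ⇒ d) with a ≟F c | b ≟F d
... | yes p | yes q = yes (cong₂ _⇒_ p q)
... | no ¬p | _     = no (λ e → ¬p (⇒-injˡ e))
... | yes _ | no ¬q = no (λ e → ¬q (⇒-injʳ e))

-- Distinct letters: C = atom 0, D i = atom i (used only for i ≥ 1).
C : Formula
C = atom 0

D : ℕ → Formula
D i = atom i

χ : Formula → Formula → Formula
χ X Y = (((X ⇒ Y) ⇒ X) ⇒ X) ⇒ Y

-- ξ 0 = C is an auxiliary base case, so that ξ 1 = χ[D₁, C] and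
-- ξ (i+1) = χ[D (i+1), ξ i] as in the paper.
ξ : ℕ → Formula
ξ zero    = C
ξ (suc i) = χ (D (suc i)) (ξ i)

φ : ℕ → Formula
φ i = ξ i ⇒ C

-- Natural deduction derivations of M→ (Prawitz style).  Γ lists the
-- discharge slots available; each assumption leaf (var) points to the
-- slot that will discharge it (an →I below it) or, if Γ ≠ [], is open.
-- →I discharges exactly the leaves pointing to its slot (any number, incl. 0).
infix 4 _⊢_
data _⊢_ (Γ : List Formula) : Formula → Set where
  var  : ∀ {α} → α ∈ Γ → Γ ⊢ α
  ⇒I   : ∀ {α β} → (α ∷ Γ) ⊢ β → Γ ⊢ α ⇒ β
  ⇒E   : ∀ {α β} → Γ ⊢ α ⇒ β → Γ ⊢ α → Γ ⊢ β

Proof : Formula → Set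
Proof φ = [] ⊢ φ

IsIntro : ∀ {Γ α} → Γ ⊢ α → Set
IsIntro (var _)   = ⊥
IsIntro (⇒I _)    = ⊤
IsIntro (⇒E _ _)  = ⊥

data Normal {Γ : List Formula} : ∀ {α} → Γ ⊢ α → Set where
  var : ∀ {α} (x : α ∈ Γ) → Normal (var x)
  ⇒I  : ∀ {α β} {d : (α ∷ Γ) ⊢ β} → Normal d → Normal (⇒I d)
  ⇒E  : ∀ {α β} {f : Γ ⊢ α ⇒ β} {a : Γ ⊢ α} →
        ¬ IsIntro f → Normal f → Normal a → Normal (⇒E f a)

assumptionOccurrences : ∀ {Γ α} → Formula → Γ ⊢ α → ℕ
assumptionOccurrences F (var {α} _) with α ≟F F
... | yes _ = 1
... | no _  = 0
assumptionOccurrences F (⇒I d)   = assumptionOccurrences F d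
assumptionOccurrences F (⇒E f a) = assumptionOccurrences F f Data.Nat.+ assumptionOccurrences F a

module Submission where

-- Write A_k, H_k, B_k for the formulas with ξ (k+1) = A_k ⇒ ξ k, namely
--   B_k = D_{k+1} ⇒ ξ_k,  H_k = B_k ⇒ D_{k+1},  A_k = H_k ⇒ D_{k+1}.
-- A normal proof of φ_i = ξ_i ⇒ C is an →I over a normal derivation of
-- C = ξ_0 from ξ_i.  Inside it every open assumption is ξ_i, some A_m, H_m
-- or D_{m+1} (the context invariant 'Hyp'), and a neutral (non-introduction)
-- subderivation is an application spine whose head is such an assumption
-- ('head-of-neutral').  Hence a normal derivation of ξ_t is either an →I
-- (adding A_{t-1}), the leaf ξ_i itself, or ξ_{t+1} applied to a derivation
-- of A_t; a derivation of A_t, unless A_t or D_{t+1} is already assumed, must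
-- go H_t ⊢ D_{t+1} via H_t applied to B_t, and so contains a derivation of
-- ξ_t again.  Call an index blocked once A_t or D_{t+1} has been assumed;
-- then every normal derivation of ξ_t contains at least
--   weight S t = ∏_{t ≤ j < i} (1 if j is blocked, 2 otherwise)
-- occurrences of ξ_i (mutual induction 'ξ-bound', 'A-bound', 'D-bound',
-- 'B-bound').  At the start nothing is blocked, giving 2^i.

open import Defs
open import Data.Nat using (ℕ; zero; suc; _+_; _*_; _∸_; _^_; _≤_; _<_; _≤?_; _≟_)
open import Data.Nat.Properties
  using (≤-refl; ≤-reflexive; ≤-trans; n≤1+n; m≤m+n; m≤n+m; +-mono-≤; +-identityʳ; *-identityˡ;
         m≤n⇒m∸n≡0; +-∸-assoc; ≰⇒>; <-irrefl; 1+n≢0; module ≤-Reasoning)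
open import Data.Bool using (if_then_else_)
open import Data.List using (List; []; _∷_)
open import Data.List.Membership.Propositional using (_∈_; _∉_)
open import Data.List.Membership.DecPropositional _≟_ using (_∈?_)
open import Data.List.Relation.Unary.Any using (here; there)
open import Data.List.Relation.Unary.All using (All; []; _∷_; lookup)
import Data.List.Relation.Unary.All as All
open import Data.Product using (∃; _×_; _,_)
open import Data.Empty using (⊥; ⊥-elim)
open import Data.Unit using (tt)
open import Relation.Nullary using (¬_; Dec; yes; no; does)
open import Relation.Binary.PropositionalEquality
  using (_≡_; _≢_; refl; sym; trans; cong; cong₂; subst)

-- The formulas of level k, so that ξ (suc k) is definitionally A k ⇒ ξ k.
B H A : ℕ → Formula
B k = D (suc k) ⇒ ξ k
H k = B k ⇒ D (suc k)
A k = H k ⇒ D (suc k)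

-- The final atom of a formula: the letter it ends in.  Every ξ t ends in C,
-- while A_k, H_k and D_{k+1} end in D_{k+1}; this separates the two kinds.
finalAtom : Formula → ℕ
finalAtom (atom n) = n
finalAtom (_ ⇒ β)  = finalAtom β

finalAtom-ξ : ∀ t → finalAtom (ξ t) ≡ 0
finalAtom-ξ zero    = refl
finalAtom-ξ (suc t) = finalAtom-ξ t

-- ξ is injective: the letter D_{s} in ξ s determines s.
ξ-injective : ∀ {s t} → ξ s ≡ ξ t → s ≡ t
ξ-injective {zero}  {zero}  _  = refl
ξ-injective {suc s} {suc t} refl = refl

-- B_k is not any ξ s: its antecedent is a letter, that of ξ (s+1) is A_s.
B≢ξ : ∀ {k s} → B k ≢ ξ s
B≢ξ {s = zero}  ()
B≢ξ {s = suc s} ()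

infix 4 _⊑_
data _⊑_ (F : Formula) : Formula → Set where
  here  : F ⊑ F
  there : ∀ {α β} → F ⊑ β → F ⊑ α ⇒ β

⊑-codomain : ∀ {α β G} → α ⇒ β ⊑ G → β ⊑ G
⊑-codomain here      = there here
⊑-codomain (there p) = there (⊑-codomain p)

⊑-finalAtom : ∀ {F G} → F ⊑ G → finalAtom F ≡ finalAtom G
⊑-finalAtom here      = refl
⊑-finalAtom (there p) = ⊑-finalAtom p

⊑-ξ : ∀ {F} t → F ⊑ ξ t → ∃ λ s → s ≤ t × F ≡ ξ s
⊑-ξ (suc t) (there p) with ⊑-ξ t p
... | s , s≤t , eq = s , ≤-trans s≤t (n≤1+n t) , eq
⊑-ξ t       here      = t , ≤-refl , refl

-- Head of a neutral derivation: a normal derivation not ending in →I is an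
-- assumption applied to a spine of arguments, so its conclusion is a final
-- segment of an assumption formula.
head-of-neutral : ∀ {Γ F} (e : Γ ⊢ F) → Normal e → ¬ IsIntro e →
                  ∃ λ G → G ∈ Γ × F ⊑ G
head-of-neutral (var x)  _                 _  = _ , x , here
head-of-neutral (⇒I _)   _                 ni = ⊥-elim (ni tt)
head-of-neutral (⇒E f _) (⇒E nif nf _) _ with head-of-neutral f nf nif
... | G , x , p = G , x , ⊑-codomain p

-- The assumptions that can be open inside a normal proof of φ i, given the
-- list S of blocked indices: ξ_i, H_m, and A_m or D_{m+1} with m blocked.
data Hyp (i : ℕ) (S : List ℕ) : Formula → Set where
  ξ-hyp : ∀ {F} → F ≡ ξ i → Hyp i S F
  A-hyp : ∀ {m} → m ∈ S → Hyp i S (A m)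
  H-hyp : ∀ m → Hyp i S (H m)
  D-hyp : ∀ {m} → m ∈ S → Hyp i S (D (suc m))

Hyp-block : ∀ {i S F} s → Hyp i S F → Hyp i (s ∷ S) F
Hyp-block s (ξ-hyp eq) = ξ-hyp eq
Hyp-block s (A-hyp b)  = A-hyp (there b)
Hyp-block s (H-hyp m)  = H-hyp m
Hyp-block s (D-hyp b)  = D-hyp (there b)

hyp-ending-in-C : ∀ {i S G} → Hyp i S G → finalAtom G ≡ 0 → G ≡ ξ i
hyp-ending-in-C (ξ-hyp eq) _ = eq

neutral-ending-in-C : ∀ {i S Γ F} → All (Hyp i S) Γ → (e : Γ ⊢ F) → Normal e → ¬ IsIntro e →
                      finalAtom F ≡ 0 → ∃ λ s → s ≤ i × F ≡ ξ s
neutral-ending-in-C {i} al e ne ni c with head-of-neutral e ne ni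
... | G , x , p = ⊑-ξ i (subst (_ ⊑_) G≡ξi p)
  where
  G≡ξi : G ≡ ξ i
  G≡ξi = hyp-ending-in-C (lookup al x) (trans (sym (⊑-finalAtom p)) c)

letter-⊑-ξ : ∀ {F k t} → finalAtom F ≡ suc k → F ⊑ ξ t → ⊥
letter-⊑-ξ {t = t} c p = 1+n≢0 (trans (sym c) (trans (⊑-finalAtom p) (finalAtom-ξ t)))

letter-≢-ξ : ∀ {F k t} → finalAtom F ≡ suc k → F ≢ ξ t
letter-≢-ξ {F} c eq = letter-⊑-ξ c (subst (F ⊑_) eq here)

factor : List ℕ → ℕ → ℕ
factor S j = if does (j ∈? S) then 1 else 2

factor-blocked : ∀ {S j} → j ∈ S → factor S j ≡ 1
factor-blocked {S} {j} b with j ∈? S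
... | yes _ = refl
... | no ¬b = ⊥-elim (¬b b)

factor-open : ∀ {S j} → j ∉ S → factor S j ≡ 2
factor-open {S} {j} ¬b with j ∈? S
... | yes b = ⊥-elim (¬b b)
... | no _  = refl

factor-block-other : ∀ {S j s} → j ≢ s → factor (s ∷ S) j ≡ factor S j
factor-block-other {S} {j} {s} j≢s = by-cases (j ∈? S)
  where
  by-cases : Dec (j ∈ S) → factor (s ∷ S) j ≡ factor S j
  by-cases (yes b) = trans (factor-blocked {s ∷ S} (there b)) (sym (factor-blocked {S} b))
  by-cases (no ¬b) = trans (factor-open {s ∷ S} λ { (here j≡s) → j≢s j≡s ; (there b) → ¬b b })
                           (sym (factor-open {S} ¬b))

weightFrom : List ℕ → ℕ → ℕ → ℕ
weightFrom S t zero    = 1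
weightFrom S t (suc n) = factor S t * weightFrom S (suc t) n

weightFrom-block-below : ∀ {S s} t n → s < t → weightFrom (s ∷ S) t n ≡ weightFrom S t n
weightFrom-block-below     t zero    _   = refl
weightFrom-block-below {S} t (suc n) s<t =
  cong₂ _*_ (factor-block-other {S} (λ { refl → <-irrefl refl s<t }))
            (weightFrom-block-below (suc t) n (≤-trans s<t (n≤1+n t)))

weightFrom-unblocked : ∀ t n → weightFrom [] t n ≡ 2 ^ n
weightFrom-unblocked t zero    = refl
weightFrom-unblocked t (suc n) = cong (2 *_) (weightFrom-unblocked (suc t) n)

module _ {i S Γ} (al : All (Hyp i S) Γ) where

  -- The major premise of an elimination concluding ξ t is a neutral
  -- derivation of A_t ⇒ ξ_t, a final segment of the assumption ξ_i.
  ξ-major : ∀ {α t} (f : Γ ⊢ α ⇒ ξ t) → Normal f → ¬ IsIntro f → α ≡ A t × t < i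
  ξ-major {t = t} f nf ni with neutral-ending-in-C al f nf ni (finalAtom-ξ t)
  ... | zero  , _   , ()
  ... | suc s , s<i , eq with ξ-injective (⇒-injʳ eq)
  ... | refl = ⇒-injˡ eq , s<i

  -- B_k ends in C but is no ξ s, so it has no neutral derivation.
  no-neutral-B : ∀ {k} (e : Γ ⊢ B k) → Normal e → ¬ IsIntro e → ⊥
  no-neutral-B {k} e ne ni with neutral-ending-in-C al e ne ni (finalAtom-ξ k)
  ... | _ , _ , eq = B≢ξ eq

  -- If k is not blocked, A_k has no neutral derivation: its head would be A_k.
  no-neutral-A : ∀ {k} → k ∉ S → (e : Γ ⊢ A k) → Normal e → ¬ IsIntro e → ⊥
  no-neutral-A ¬b e ne ni with head-of-neutral e ne ni
  ... | G , x , p with lookup al x | p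
  ... | ξ-hyp refl | p       = letter-⊑-ξ refl p
  ... | A-hyp b    | here    = ¬b b
  ... | A-hyp _    | there ()
  ... | H-hyp _    | there ()

module Counting (i : ℕ) where
  open ≤-Reasoning

  weight : List ℕ → ℕ → ℕ
  weight S t = weightFrom S t (i ∸ t)

  weight-beyond : ∀ S {t} → i ≤ t → weight S t ≡ 1
  weight-beyond S i≤t = cong (weightFrom S _) (m≤n⇒m∸n≡0 i≤t)

  weight-step : ∀ S {t} → t < i → weight S t ≡ factor S t * weight S (suc t)
  weight-step S {t} t<i = cong (weightFrom S t) (+-∸-assoc 1 t<i)

  weight-block : ∀ S s → weight (s ∷ S) s ≡ weight S (suc s)
  weight-block S s with i ≤? s
  ... | yes i≤s = trans (weight-beyond (s ∷ S) i≤s) (sym (weight-beyond S (≤-trans i≤s (n≤1+n s))))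
  ... | no  i≰s = begin-equality
    weight (s ∷ S) s                             ≡⟨ weight-step (s ∷ S) (≰⇒> i≰s) ⟩
    factor (s ∷ S) s * weight (s ∷ S) (suc s)    ≡⟨ cong₂ _*_ (factor-blocked {s ∷ S} (here refl))
                                                      (weightFrom-block-below (suc s) (i ∸ suc s) ≤-refl) ⟩
    1 * weight S (suc s)                         ≡⟨ *-identityˡ _ ⟩
    weight S (suc s)                             ∎

  weight-unblocked : ∀ t → weight [] t ≡ 2 ^ (i ∸ t)
  weight-unblocked t = weightFrom-unblocked t (i ∸ t)

  occ : ∀ {Γ α} → Γ ⊢ α → ℕ
  occ = assumptionOccurrences (ξ i)

  occ-leaf : ∀ {Γ} (x : ξ i ∈ Γ) → occ (var x) ≡ 1
  occ-leaf x with ξ i ≟F ξ i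
  ... | yes _  = refl
  ... | no ξ≢ξ = ⊥-elim (ξ≢ξ refl)

  mutual
    ξ-bound : ∀ {S Γ t} → All (Hyp i S) Γ → (d : Γ ⊢ ξ t) → Normal d → weight S t ≤ occ d
    ξ-bound {S} {t = suc s} al (⇒I body) (⇒I nb) =
      subst (_≤ occ body) (weight-block S s)
        (ξ-bound (A-hyp (here refl) ∷ All.map (Hyp-block s) al) body nb)
    ξ-bound {t = t} al (var x) _ with ξ-injective (hyp-ending-in-C (lookup al x) (finalAtom-ξ t))
    ... | refl = ≤-reflexive (trans (weight-beyond _ ≤-refl) (sym (occ-leaf x)))
    ξ-bound {S} {t = t} al (⇒E f a) (⇒E nif nf na) with ξ-major al f nf nif
    ... | refl , t<i with t ∈? S
    ... | yes b = begin
      weight S t                        ≡⟨ weight-step S t<i ⟩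
      factor S t * weight S (suc t)     ≡⟨ cong (_* weight S (suc t)) (factor-blocked {S} b) ⟩
      1 * weight S (suc t)              ≡⟨ *-identityˡ _ ⟩
      weight S (suc t)                  ≤⟨ ξ-bound al f nf ⟩
      occ f                             ≤⟨ m≤m+n _ _ ⟩
      occ f + occ a                     ∎
    ... | no ¬b = begin
      weight S t                        ≡⟨ weight-step S t<i ⟩
      factor S t * weight S (suc t)     ≡⟨ cong (_* weight S (suc t)) (factor-open {S} ¬b) ⟩
      2 * weight S (suc t)              ≡⟨ cong (weight S (suc t) +_) (+-identityʳ _) ⟩
      weight S (suc t) + weight S (suc t) ≤⟨ +-mono-≤ (ξ-bound al f nf) (A-bound ¬b al a na) ⟩
      occ f + occ a                     ∎

    -- With k unblocked, a derivation of A_k is H_k ⊢ D_{k+1} closed by →I.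
    A-bound : ∀ {S Γ k} → k ∉ S → All (Hyp i S) Γ → (d : Γ ⊢ A k) → Normal d →
              weight S (suc k) ≤ occ d
    A-bound ¬b al (⇒I body) (⇒I nb) = D-bound ¬b (H-hyp _ ∷ al) body nb
    A-bound ¬b al (var x)   nd      = ⊥-elim (no-neutral-A al ¬b (var x) nd λ ())
    A-bound ¬b al (⇒E f a)  nd      = ⊥-elim (no-neutral-A al ¬b (⇒E f a) nd λ ())

    -- With k unblocked, D_{k+1} can only be obtained by applying H_k to B_k.
    D-bound : ∀ {S Γ k} → k ∉ S → All (Hyp i S) Γ → (d : Γ ⊢ D (suc k)) → Normal d →
              weight S (suc k) ≤ occ d
    D-bound ¬b al (var x) _ with lookup al x
    ... | ξ-hyp eq = ⊥-elim (letter-≢-ξ refl eq)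
    ... | D-hyp b  = ⊥-elim (¬b b)
    D-bound ¬b al (⇒E f a) (⇒E nif nf na) with head-of-neutral f nf nif
    ... | G , x , p with lookup al x | p
    ... | ξ-hyp refl | p        = ⊥-elim (letter-⊑-ξ refl p)
    ... | A-hyp b    | here     = ⊥-elim (¬b b)
    ... | A-hyp _    | there ()
    ... | H-hyp _    | here     = ≤-trans (B-bound al a na) (m≤n+m _ _)
    ... | H-hyp _    | there ()

    -- A derivation of B_k is D_{k+1} ⊢ ξ_k closed by →I, which blocks k.
    B-bound : ∀ {S Γ k} → All (Hyp i S) Γ → (d : Γ ⊢ B k) → Normal d → weight S (suc k) ≤ occ d
    B-bound {S} {k = k} al (⇒I body) (⇒I nb) =
      subst (_≤ occ body) (weight-block S k)
        (ξ-bound (D-hyp (here refl) ∷ All.map (Hyp-block k) al) body nb)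
    B-bound al (var x)  nd = ⊥-elim (no-neutral-B al (var x) nd λ ())
    B-bound al (⇒E f a) nd = ⊥-elim (no-neutral-B al (⇒E f a) nd λ ())

-- A normal proof of φ i is →I over a derivation of C = ξ 0 from ξ i alone,
-- in which nothing is blocked yet.
theorem1 : (i : ℕ) → 1 ≤ i → (d : Proof (φ i)) → Normal d →
           2 ^ i ≤ assumptionOccurrences (ξ i) d
theorem1 i _ (⇒I body) (⇒I nb) =
  subst (_≤ assumptionOccurrences (ξ i) body) (weight-unblocked 0)
    (ξ-bound (ξ-hyp refl ∷ []) body nb)
  where open Counting i
theorem1 i _ (var ())  _
theorem1 i _ (⇒E f _) (⇒E nif nf _) with head-of-neutral f nf nif
... | _ , () , _
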